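{- Let $t\ge 2$ and $m\ge 1$ be integers. Let $S^+_{m,t}$ be the set of $(t,mt+1)$-core partitions with distinct parts, and let $\mathcal{C}^+_{m,t}$ be the set of all sequences $(x_1,\ldots,x_{t-1})\in\mathbb{N}^{t-1}$ with $0\le x_i\le m$ for $1\le i\le t-1$ and $x_ix_{i+1}=0$ for $1\le i\le t-2$. Then the map $\psi(\lambda)=(n_1(\lambda),n_2(\lambda),\ldots,n_{t-1}(\lambda))$ is a bijection from $S^+_{m,t}$ to $\mathcal{C}^+_{m,t}$.
   Context: A partition is a finite weakly decreasing sequence $\lambda=(\lambda_1,\ldots,\lambda_\ell)$ of positive integers; it has distinct parts if $\lambda_1>\cdots>\lambda_\ell$. The hook length of box $(i,j)$ of the Young diagram is the number of boxes directly to its right, directly below it, plus the box itself; $\lambda$ is an $s$-core if no hook length is divisible by $s$, and a $(t_1,t_2)$-core if it is both a $t_1$-core and a $t_2$-core. The $\beta$-set of $\lambda$ is $\beta(\lambda)=\{\lambda_i+\ell-i:1\le i\le \ell\}$. For $1\le i\le t-1$, $n_i(\lambda)$ denotes the number of integers $x\in\beta(\lambda)$ with $x\equiv i\pmod t$. $\mathbb{N}$ includes $0$. -}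

module Defs where

open import Data.Nat using (ℕ; zero; suc; _+_; _*_; _∸_; _≤_; _<_; _>_; _≥_; _%_; _≟_; _<?_)
open import Data.Nat.Divisibility using (_∣_)
open import Data.List using (List; []; _∷_; length; filter; map; upTo; applyUpTo)
open import Data.List.Relation.Unary.All using (All)
open import Data.List.Relation.Unary.Linked using (Linked)
open import Data.Product using (_×_)
open import Data.Unit using (⊤)
open import Relation.Nullary using (¬_)
open import Relation.Binary.PropositionalEquality using (_≡_)

-- Partitions are represented as lists of parts (λ₁, …, λ_ℓ), indices 0-based.

IsPartition : List ℕ → Set
IsPartition l = All (1 ≤_) l × Linked _≥_ l

IsDistinctPartition : List ℕ → Set
IsDistinctPartition l = All (1 ≤_) l × Linked _>_ l

-- i-th part (0-based), 0 beyond the length.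
part : List ℕ → ℕ → ℕ
part []      _       = 0
part (x ∷ _) zero    = x
part (_ ∷ l) (suc i) = part l i

conj : List ℕ → ℕ → ℕ
conj l j = length (filter (λ x → j <? x) l)

-- hook length of box (i,j) (0-based): arm + leg + 1
hook : List ℕ → ℕ → ℕ → ℕ
hook l i j = (part l i ∸ suc j) + (conj l j ∸ suc i) + 1

IsBox : List ℕ → ℕ → ℕ → Set
IsBox l i j = i < length l × j < part l i

IsCore : ℕ → List ℕ → Set
IsCore s l = ∀ i j → IsBox l i j → ¬ (s ∣ hook l i j)

IsCore₂ : ℕ → ℕ → List ℕ → Set
IsCore₂ t₁ t₂ l = IsCore t₁ l × IsCore t₂ l

-- β-set {λ_i + ℓ - i : 1 ≤ i ≤ ℓ}, as the list over i (0-based k = i-1: λ_{k} + ℓ - 1 - k)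
beta : List ℕ → List ℕ
beta l = applyUpTo (λ k → part l k + (length l ∸ suc k)) (length l)

-- x mod t (t = 0 case is irrelevant; only used for t ≥ 2)
modℕ : ℕ → ℕ → ℕ
modℕ x zero    = x
modℕ x (suc t) = x % suc t

nCount : ℕ → ℕ → List ℕ → ℕ
nCount t i l = length (filter (λ x → modℕ x t ≟ i) (beta l))

ψ : ℕ → List ℕ → List ℕ
ψ t l = map (λ i → nCount t i l) (map suc (upTo (t ∸ 1)))

InS : ℕ → ℕ → List ℕ → Set
InS m t l = IsDistinctPartition l × IsCore₂ t (m * t + 1) l

AdjZero : List ℕ → Set
AdjZero []           = ⊤
AdjZero (_ ∷ [])     = ⊤
AdjZero (x ∷ y ∷ r)  = (x * y ≡ 0) × AdjZero (y ∷ r)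

InC : ℕ → ℕ → List ℕ → Set
InC m t x = (length x ≡ t ∸ 1) × All (_≤ m) x × AdjZero x

module Submission where

-- Hence λ is an s-core iff β(λ) is
--     closed under x ↦ x − s (`core⇒closed`, `closed⇒core`).
--  4. Runners: in a T-closed decreasing list the elements ≡ i (mod T) are exactly
--     i, i + T, …, i + (nᵢ − 1)T, so the bead i + qT is present iff q < nᵢ.
--  5. The theorem, for T = t: runner 0 is empty since 0 ∉ β(λ); nᵢ > m would put both
--     i + mT and (after subtracting mT + 1) i − 1 next to i in β(λ); two adjacent
--     nonempty runners put i, i + 1 in β(λ).  So ψ lands in C⁺ and determines β(λ).
--     Conversely, for x ∈ C⁺ the set {i + qT : 1 ≤ i < T, q < xᵢ} is gapped, T-closed
--     and lies below mT, hence is (mT + 1)-closed; it is the β-set of a preimage.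

open import Defs
open import Data.Nat using (ℕ; zero; suc; _+_; _*_; _∸_; _≤_; _<_; _>_; _%_; _/_; _≟_; _<?_; z≤n; s≤s)
open import Data.Nat.Properties
open import Data.Nat.DivMod using (m≡m%n+[m/n]*n; m%n≡m∸m/n*n; m/n*n≤m; [m+kn]%n≡m%n; m<n⇒m%n≡m; m%n<n; m≤n⇒[n∸m]%m≡n%m)
open import Data.Nat.Divisibility using (_∣_; divides; ∣-refl)
open import Data.Nat.Tactic.RingSolver using (solve-∀)
open import Data.List using (List; []; _∷_; length; filter; map; applyUpTo; applyDownFrom; downFrom)
open import Data.List.Properties using (filter-accept; filter-reject; map-upTo; map-applyUpTo; length-applyUpTo; ∷-injective)
open import Data.List.Relation.Unary.All as All using (All; []; _∷_)
open import Data.List.Relation.Unary.All.Properties using (all-filter; applyUpTo⁺₂)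
open import Data.List.Relation.Unary.AllPairs using (_∷_)
open import Data.List.Relation.Unary.Linked as Linked using (Linked; []; [-]; _∷_)
open import Data.List.Relation.Unary.Linked.Properties using (Linked⇒AllPairs; filter⁺; applyDownFrom⁺₂)
open import Data.List.Membership.Propositional using (_∈_; _∉_)
open import Data.List.Membership.Propositional.Properties using (∈-filter⁺; ∈-filter⁻; ∈-applyDownFrom⁺; ∈-applyDownFrom⁻; ∈-downFrom⁺; ∈-downFrom⁻)
open import Data.List.Membership.DecPropositional _≟_ using (_∈?_)
open import Data.List.Relation.Unary.Any using (here; there)
open import Data.Product using (_×_; ∃; ∃₂; _,_; proj₁; proj₂)
open import Data.Empty using (⊥; ⊥-elim)
open import Data.Unit using (tt)
open import Relation.Binary.Definitions using (Transitive)
open import Relation.Nullary using (¬_; Dec; yes; no)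
open import Relation.Nullary.Decidable using (_×-dec_; ¬?)
open import Relation.Binary.PropositionalEquality

≡-by-lower-sets : ∀ {n p} → (∀ {q} → q < n → q < p) → (∀ {q} → q < p → q < n) → n ≡ p
≡-by-lower-sets {n} {p} n⊆p p⊆n = ≤-antisym (lower n n⊆p) (lower p p⊆n)
  where
    lower : ∀ n {p} → (∀ {q} → q < n → q < p) → n ≤ p
    lower zero    _   = z≤n
    lower (suc n) n⊆p = n⊆p ≤-refl

product-zero : ∀ a b → (0 < a → 0 < b → ⊥) → a * b ≡ 0
product-zero zero    _       _    = refl
product-zero (suc a) zero    _    = *-zeroʳ (suc a)
product-zero (suc _) (suc _) both = ⊥-elim (both (s≤s z≤n) (s≤s z≤n))

product-zero⁻ : ∀ {a b} → a * b ≡ 0 → 0 < a → 0 < b → ⊥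
product-zero⁻ {suc _} {suc _} ()

part-table : ∀ xs → xs ≡ applyUpTo (part xs) (length xs)
part-table []       = refl
part-table (x ∷ xs) = cong (x ∷_) (part-table xs)

applyUpTo-cong : ∀ (f g : ℕ → ℕ) n → (∀ {j} → j < n → f j ≡ g j) → applyUpTo f n ≡ applyUpTo g n
applyUpTo-cong f g zero    _   = refl
applyUpTo-cong f g (suc n) f≗g =
  cong₂ _∷_ (f≗g (s≤s z≤n)) (applyUpTo-cong (λ k → f (suc k)) (λ k → g (suc k)) n (λ j<n → f≗g (s≤s j<n)))

applyUpTo-injective : ∀ (f g : ℕ → ℕ) n → applyUpTo f n ≡ applyUpTo g n → ∀ {j} → j < n → f j ≡ g j
applyUpTo-injective f g (suc n) eq {zero}  _         = proj₁ (∷-injective eq)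
applyUpTo-injective f g (suc n) eq {suc j} (s≤s j<n) =
  applyUpTo-injective (λ k → f (suc k)) (λ k → g (suc k)) n (proj₂ (∷-injective eq)) j<n

AdjZero-table : ∀ h n → (∀ j → h j * h (suc j) ≡ 0) → AdjZero (applyUpTo h n)
AdjZero-table h zero          _   = tt
AdjZero-table h (suc zero)    _   = tt
AdjZero-table h (suc (suc n)) adj = adj 0 , AdjZero-table (λ k → h (suc k)) (suc n) (λ j → adj (suc j))

AdjZero-part : ∀ xs → AdjZero xs → ∀ k → part xs k * part xs (suc k) ≡ 0
AdjZero-part []          _       _       = refl
AdjZero-part (x ∷ [])    _       zero    = *-zeroʳ x
AdjZero-part (x ∷ [])    _       (suc k) = refl
AdjZero-part (x ∷ y ∷ r) (xy , _) zero   = xy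
AdjZero-part (x ∷ y ∷ r) (_ , adj) (suc k) = AdjZero-part (y ∷ r) adj k

part-bounded : ∀ {m} xs → All (_≤ m) xs → ∀ k → part xs k ≤ m
part-bounded []       _         _       = z≤n
part-bounded (x ∷ xs) (x≤m ∷ _) zero    = x≤m
part-bounded (x ∷ xs) (_ ∷ xs≤m) (suc k) = part-bounded xs xs≤m k

part-All : ∀ {P : ℕ → Set} r {i} → All P r → i < length r → P (part r i)
part-All (_ ∷ _) {zero}  (p ∷ _)  _         = p
part-All (_ ∷ r) {suc i} (_ ∷ ps) (s≤s i<r) = part-All r ps i<r

head-related : ∀ {R : ℕ → ℕ → Set} → Transitive R → ∀ {a r} → Linked R (a ∷ r) → All (R a) r
head-related trans lin with a≺r ∷ _ ← Linked⇒AllPairs trans lin = a≺r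

below-head : ∀ {a r} → Linked _>_ (a ∷ r) → All (_< a) r
below-head = head-related (λ x>y y>z → <-trans y>z x>y)

head-max : ∀ {h B x} → Linked _>_ (h ∷ B) → x ∈ h ∷ B → x ≤ h
head-max _   (here refl) = ≤-refl
head-max lin (there x∈B) = <⇒≤ (All.lookup (below-head lin) x∈B)

∉-above-head : ∀ {h B y} → Linked _>_ (h ∷ B) → h < y → y ∉ h ∷ B
∉-above-head lin h<y y∈ = <⇒≱ h<y (head-max lin y∈)

tail-⊆ : ∀ {h h′ B B′} → Linked _>_ (h ∷ B) → h ≡ h′ →
         (∀ {x} → x ∈ h ∷ B → x ∈ h′ ∷ B′) → ∀ {x} → x ∈ B → x ∈ B′
tail-⊆ lin h≡h′ ⊆ x∈B with ⊆ (there x∈B)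
... | there x∈B′ = x∈B′
... | here refl  = ⊥-elim (<-irrefl (sym h≡h′) (All.lookup (below-head lin) x∈B))

decreasing-ext : ∀ {B B′} → Linked _>_ B → Linked _>_ B′ →
                 (∀ {x} → x ∈ B → x ∈ B′) → (∀ {x} → x ∈ B′ → x ∈ B) → B ≡ B′
decreasing-ext {[]}    {[]}    _ _ _ _ = refl
decreasing-ext {[]}    {_ ∷ _} _ _ _ ⊇ with ⊇ (here refl)
... | ()
decreasing-ext {_ ∷ _} {[]}    _ _ ⊆ _ with ⊆ (here refl)
... | ()
decreasing-ext {h ∷ B} {h′ ∷ B′} lin lin′ ⊆ ⊇ =
  cong₂ _∷_ h≡h′ (decreasing-ext (Linked.tail lin) (Linked.tail lin′) (tail-⊆ lin h≡h′ ⊆) (tail-⊆ lin′ (sym h≡h′) ⊇))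
  where
    h≡h′ : h ≡ h′
    h≡h′ = ≤-antisym (head-max lin′ (⊆ (here refl))) (head-max lin (⊇ (here refl)))

length≤head : ∀ {y ys} → Linked _>_ (y ∷ ys) → length ys ≤ y
length≤head [-]         = z≤n
length≤head (y>y′ ∷ lin) = ≤-trans (s≤s (length≤head lin)) y>y′

length<head : ∀ {y ys} → Linked _>_ (y ∷ ys) → All (1 ≤_) (y ∷ ys) → length ys < y
length<head [-]         (y≥1 ∷ _) = y≥1
length<head (y>y′ ∷ lin) (_ ∷ pos) = ≤-trans (s≤s (length<head lin pos)) y>y′

Gap : ℕ → ℕ → Set
Gap x y = suc y < x

gap⇒decreasing : ∀ {B} → Linked Gap B → Linked _>_ B
gap⇒decreasing = Linked.map (λ gap → <-trans (n<1+n _) gap)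

gap-trans : Transitive Gap
gap-trans x>y y>z = <-trans y>z (<-trans (n<1+n _) x>y)

no-consecutive : ∀ {B x} → Linked Gap B → x ∈ B → suc x ∈ B → ⊥
no-consecutive         _   (here refl) (here 1+x≡x) = 1+n≢n 1+x≡x
no-consecutive {h ∷ _} lin (here refl) (there m)    =
  <-asym (All.lookup (head-related gap-trans lin) m) (<-trans (n<1+n h) (n<1+n (suc h)))
no-consecutive         lin (there m)   (here refl)  = <-irrefl refl (All.lookup (head-related gap-trans lin) m)
no-consecutive         lin (there m)   (there m′)   = no-consecutive (Linked.tail lin) m m′

decreasing⇒gap : ∀ {B} → Linked _>_ B → (∀ {x} → x ∈ B → suc x ∈ B → ⊥) → Linked Gap B
decreasing⇒gap []          _  = []
decreasing⇒gap [-]         _  = [-]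
decreasing⇒gap (x>y ∷ lin) nc =
  ≤∧≢⇒< x>y (λ 1+y≡x → nc (there (here refl)) (here 1+y≡x)) ∷ decreasing⇒gap lin (λ m m′ → nc (there m) (there m′))

-- β-sets.  By computation β(a ∷ r) = (a + |r|) ∷ β(r), which drives every induction below.

beta-gap : ∀ l → Linked _>_ l → Linked Gap (beta l)
beta-gap []          _           = []
beta-gap (a ∷ [])    _           = [-]
beta-gap (a ∷ b ∷ r) (a>b ∷ lin) = head-gap ∷ beta-gap (b ∷ r) lin
  where head-gap : suc (b + length r) < a + suc (length r)
        head-gap = subst (suc (b + length r) <_) (sym (+-suc a (length r))) (s≤s (+-monoˡ-< (length r) a>b))

beta-positive : ∀ l → All (1 ≤_) l → All (1 ≤_) (beta l)
beta-positive []      []          = []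
beta-positive (a ∷ r) (a≥1 ∷ pos) = ≤-trans a≥1 (m≤m+n a (length r)) ∷ beta-positive r pos

beta-injective : ∀ l l′ → beta l ≡ beta l′ → l ≡ l′
beta-injective []      []       _  = refl
beta-injective (a ∷ r) (a′ ∷ r′) eq with refl ← beta-injective r r′ (proj₂ (∷-injective eq)) =
  cong (_∷ r) (+-cancelʳ-≡ (length r) a a′ (proj₁ (∷-injective eq)))

unbeta : List ℕ → List ℕ
unbeta []       = []
unbeta (y ∷ ys) = (y ∸ length ys) ∷ unbeta ys

length-unbeta : ∀ ys → length (unbeta ys) ≡ length ys
length-unbeta []       = refl
length-unbeta (_ ∷ ys) = cong suc (length-unbeta ys)

beta-unbeta : ∀ B → Linked _>_ B → beta (unbeta B) ≡ B
beta-unbeta []       _   = refl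
beta-unbeta (y ∷ ys) lin =
  cong₂ _∷_ (trans (cong ((y ∸ length ys) +_) (length-unbeta ys)) (m∸n+n≡m (length≤head lin)))
            (beta-unbeta ys (Linked.tail lin))

unbeta-positive : ∀ B → Linked _>_ B → All (1 ≤_) B → All (1 ≤_) (unbeta B)
unbeta-positive []       _   _           = []
unbeta-positive (y ∷ ys) lin (y≥1 ∷ pos) = m<n⇒0<n∸m (length<head lin (y≥1 ∷ pos)) ∷ unbeta-positive ys (Linked.tail lin) pos

unbeta-decreasing : ∀ B → Linked Gap B → Linked _>_ (unbeta B)
unbeta-decreasing []            _          = []
unbeta-decreasing (y ∷ [])      _          = [-]
unbeta-decreasing (y ∷ y′ ∷ ys) (gap ∷ lin) = head-gap ∷ unbeta-decreasing (y′ ∷ ys) lin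
  where head-gap : y′ ∸ length ys < y ∸ suc (length ys)
        head-gap = subst (_≤ y ∸ suc (length ys)) (+-∸-assoc 1 (length≤head (gap⇒decreasing lin)))
                         (∸-monoˡ-≤ (suc (length ys)) gap)

-- Hook lengths and the abacus criterion for s-cores

conj-suc : ∀ {a j} r → j < a → conj (a ∷ r) j ≡ suc (conj r j)
conj-suc {a} {j} r j<a = cong length (filter-accept (j <?_) j<a)

conj-same : ∀ {a j} r → ¬ j < a → conj (a ∷ r) j ≡ conj r j
conj-same {a} {j} r j≮a = cong length (filter-reject (j <?_) j≮a)

conj-zero : ∀ {j} r → All (_≤ j) r → conj r j ≡ 0
conj-zero []      []           = refl
conj-zero (b ∷ r) (b≤j ∷ r≤j) = trans (conj-same r (λ j<b → <⇒≱ j<b b≤j)) (conj-zero r r≤j)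

conj-beyond : ∀ {a j} r → Linked _>_ (a ∷ r) → a ≤ j → conj (a ∷ r) j ≡ 0
conj-beyond r lin a≤j =
  trans (conj-same r (λ j<a → <⇒≱ j<a a≤j)) (conj-zero r (All.map (λ b<a → ≤-trans (<⇒≤ b<a) a≤j) (below-head lin)))

rowHook : List ℕ → ℕ → ℕ → ℕ
rowHook r a j = (a ∸ suc j) + conj r j + 1

hook-head : ∀ {a j} r → j < a → hook (a ∷ r) 0 j ≡ rowHook r a j
hook-head {a} {j} r j<a = cong (λ c → (a ∸ suc j) + (c ∸ 1) + 1) (conj-suc r j<a)

hook-tail : ∀ {a i j} r → j < a → hook (a ∷ r) (suc i) j ≡ hook r i j
hook-tail {a} {i} {j} r j<a = cong (λ c → (part r i ∸ suc j) + (c ∸ suc (suc i)) + 1) (conj-suc r j<a)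

rowHook-leg : ∀ r a j {c} y → conj r j ≡ c → rowHook r a j + y ≡ (a ∸ suc j) + c + 1 + y
rowHook-leg r a j y leg = cong (λ c → (a ∸ suc j) + c + 1 + y) leg

hook-pos : ∀ {r a j y N} → rowHook r a j + y ≡ N → y < N
hook-pos {r} {a} {j} {y} refl = m<n+m y (m≤n+m 1 ((a ∸ suc j) + conj r j))

-- The arithmetic of the two induction steps below: an empty leg, and a leg one longer.
hook-arith-end : ∀ {a j} k y → j < a → y ≡ j + k → (a ∸ suc j) + 0 + 1 + y ≡ a + k
hook-arith-end {a} {j} k y j<a refl = begin
    (a ∸ suc j) + 0 + 1 + (j + k) ≡⟨ regroup (a ∸ suc j) j k ⟩
    ((a ∸ suc j) + suc j) + k     ≡⟨ cong (_+ k) (m∸n+n≡m j<a) ⟩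
    a + k                         ∎
  where open ≡-Reasoning
        regroup : ∀ A j k → A + 0 + 1 + (j + k) ≡ (A + suc j) + k
        regroup = solve-∀

hook-arith-step : ∀ {a b j} c y n → j < a → j < b → (b ∸ suc j) + c + 1 + y ≡ b + n →
                  (a ∸ suc j) + suc c + 1 + y ≡ a + suc n
hook-arith-step {a} {b} {j} c y n j<a j<b eq = +-cancelʳ-≡ (B + suc j) _ _ (begin
    (A + suc c + 1 + y) + (B + suc j) ≡⟨ regroup₁ A B c y j ⟩
    (A + suc j) + (B + c + 1 + y) + 1 ≡⟨ cong₂ (λ u v → u + v + 1) (m∸n+n≡m j<a) eq ⟩
    a + (b + n) + 1                   ≡⟨ regroup₂ a b n ⟩
    (a + suc n) + b                   ≡⟨ cong ((a + suc n) +_) (sym (m∸n+n≡m j<b)) ⟩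
    (a + suc n) + (B + suc j)         ∎)
  where open ≡-Reasoning
        A = a ∸ suc j
        B = b ∸ suc j
        regroup₁ : ∀ A B c y j → (A + suc c + 1 + y) + (B + suc j) ≡ (A + suc j) + (B + c + 1 + y) + 1
        regroup₁ = solve-∀
        regroup₂ : ∀ a b n → a + (b + n) + 1 ≡ (a + suc n) + b
        regroup₂ = solve-∀

hook-hole : ∀ {a} r j → Linked _>_ (a ∷ r) → j < a →
            ∃ λ y → y ∉ beta r × rowHook r a j + y ≡ a + length r
hook-hole []          j _         j<a = j , (λ ()) , hook-arith-end 0 j j<a (sym (+-identityʳ j))
hook-hole {a} (b ∷ r) j (_ ∷ lin) j<a with j <? b
... | yes j<b with y , y∉r , eq ← hook-hole r j lin j<b =
  y , y∉b∷r , trans (rowHook-leg (b ∷ r) a j y (conj-suc r j<b)) (hook-arith-step (conj r j) y (length r) j<a j<b eq)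
  where y∉b∷r : y ∉ beta (b ∷ r)
        y∉b∷r (here y≡top) = <-irrefl y≡top (hook-pos {r} {b} eq)
        y∉b∷r (there y∈r)  = y∉r y∈r
... | no j≮b =
  j + suc (length r) , ∉-above-head (gap⇒decreasing (beta-gap (b ∷ r) lin)) top<y ,
  trans (rowHook-leg (b ∷ r) a j _ (conj-beyond r lin (≮⇒≥ j≮b))) (hook-arith-end (suc (length r)) _ j<a refl)
  where top<y : b + length r < j + suc (length r)
        top<y = ≤-<-trans (+-monoˡ-≤ (length r) (≮⇒≥ j≮b)) (+-monoʳ-< j (n<1+n (length r)))

hole-hook : ∀ {a} r y → Linked _>_ (a ∷ r) → y < a + length r → y ∉ beta r →
            ∃ λ j → j < a × rowHook r a j + y ≡ a + length r
hole-hook {a} [] y _ y<a _ = y , y<a′ , hook-arith-end 0 y y<a′ (sym (+-identityʳ y))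
  where y<a′ = subst (y <_) (+-identityʳ a) y<a
hole-hook {a} (b ∷ r) y (a>b ∷ lin) y<top′ y∉ with y <? b + length r
... | yes y<top with j , j<b , eq ← hole-hook r y lin y<top (λ y∈r → y∉ (there y∈r)) =
  j , <-trans j<b a>b ,
  trans (rowHook-leg (b ∷ r) a j y (conj-suc r j<b)) (hook-arith-step (conj r j) y (length r) (<-trans j<b a>b) j<b eq)
... | no y≮top = j , j<a , trans (rowHook-leg (b ∷ r) a j y (conj-beyond r lin b≤j)) (hook-arith-end (suc (length r)) y j<a y≡)
  where
    top<y : b + suc (length r) ≤ y
    top<y = subst (_≤ y) (sym (+-suc b (length r))) (≤∧≢⇒< (≮⇒≥ y≮top) (λ top≡y → y∉ (here (sym top≡y))))
    j = y ∸ suc (length r)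
    y≡ : y ≡ j + suc (length r)
    y≡ = sym (m∸n+n≡m (≤-trans (m≤n+m (suc (length r)) b) top<y))
    b≤j : b ≤ j
    b≤j = subst (_≤ j) (m+n∸n≡m b (suc (length r))) (∸-monoˡ-≤ (suc (length r)) top<y)
    j<a : j < a
    j<a = +-cancelʳ-< (suc (length r)) j a (subst (_< a + suc (length r)) y≡ y<top′)

-- `Closed s B`: B is closed under x ↦ x − s (for x ≥ s).  On β-sets this is the abacus
-- description of s-cores.
Closed : ℕ → List ℕ → Set
Closed s B = ∀ {x} → x ∈ B → s ≤ x → x ∸ s ∈ B

closed-iterate : ∀ {s B x} k → Closed s B → x ∈ B → k * s ≤ x → x ∸ k * s ∈ B
closed-iterate zero    _      x∈B _      = x∈B
closed-iterate {s} {B} {x} (suc k) closed x∈B sks≤x =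
  subst (_∈ B) reassoc (closed (closed-iterate k closed x∈B ks≤x) s≤x∸ks)
  where
    ks≤x = m+n≤o⇒n≤o s sks≤x
    reassoc : x ∸ k * s ∸ s ≡ x ∸ (s + k * s)
    reassoc = trans (∸-+-assoc x (k * s) s) (cong (x ∸_) (+-comm (k * s) s))
    s≤x∸ks : s ≤ x ∸ k * s
    s≤x∸ks = +-cancelʳ-≤ (k * s) s (x ∸ k * s) (subst (s + k * s ≤_) (sym (m∸n+n≡m ks≤x)) sks≤x)

-- In a decreasing s-closed list (s ≥ 1), subtracting s never lands on the head,
-- so the tail is s-closed on its own.
closed-below-head : ∀ {s x y B} → 1 ≤ s → Linked _>_ (x ∷ B) → Closed s (x ∷ B) → y ∈ x ∷ B → s ≤ y → y ∸ s ∈ B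
closed-below-head {s} {y = y} s≥1 lin closed y∈ s≤y with closed y∈ s≤y
... | there y∸s∈B = y∸s∈B
... | here y∸s≡x  = ⊥-elim (<-irrefl y∸s≡x (<-≤-trans (∸-monoʳ-< {n = s} s≥1 s≤y) (head-max lin y∈)))

closed-tail : ∀ {s x B} → 1 ≤ s → Linked _>_ (x ∷ B) → Closed s (x ∷ B) → Closed s B
closed-tail s≥1 lin closed y∈B = closed-below-head s≥1 lin closed (there y∈B)

core-tail : ∀ {s a} r → Linked _>_ (a ∷ r) → IsCore s (a ∷ r) → IsCore s r
core-tail {s} r lin core i j (i<r , j<part) s∣hook =
  core (suc i) j (s≤s i<r , j<part) (subst (s ∣_) (sym (hook-tail r j<a)) s∣hook)
  where j<a = <-trans j<part (part-All r (below-head lin) i<r)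

-- An s-core with distinct parts has an s-closed β-set: if the largest β-number x had
-- x − s ∉ β(r), then x − s would be a hole giving a first-row hook equal to s.
core⇒closed : ∀ {s} l → 1 ≤ s → Linked _>_ l → IsCore s l → Closed s (beta l)
core⇒closed (a ∷ r) s≥1 lin core (there x∈r) s≤x =
  there (core⇒closed r s≥1 (Linked.tail lin) (core-tail r lin core) x∈r s≤x)
core⇒closed {s} (a ∷ r) s≥1 lin core {x} (here refl) s≤x with x ∸ s ∈? beta r
... | yes x∸s∈r = there x∸s∈r
... | no  x∸s∉r with j , j<a , eq ← hole-hook r (x ∸ s) lin (∸-monoʳ-< s≥1 s≤x) x∸s∉r =
  ⊥-elim (core 0 j (s≤s z≤n , j<a) (subst (s ∣_) (sym (trans (hook-head r j<a) rowHook≡s)) ∣-refl))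
  where rowHook≡s : rowHook r a j ≡ s
        rowHook≡s = +-cancelʳ-≡ (x ∸ s) _ _ (trans eq (trans (sym (m∸n+n≡m s≤x)) (+-comm (x ∸ s) s)))

-- Conversely an s-closed β-set has no hook divisible by s: a first-row hook ks comes
-- from a hole y = x − ks below the largest β-number x, but closure puts y in β.
closed⇒core : ∀ {s} l → 1 ≤ s → Linked _>_ l → Closed s (beta l) → IsCore s l
closed⇒core {s} (a ∷ r) s≥1 lin closed (suc i) j (s≤s i<r , j<part) s∣hook =
  closed⇒core r s≥1 (Linked.tail lin) (closed-tail s≥1 (gap⇒decreasing (beta-gap (a ∷ r) lin)) closed) i j (i<r , j<part)
    (subst (s ∣_) (hook-tail r (<-trans j<part (part-All r (below-head lin) i<r))) s∣hook)
closed⇒core {s} (a ∷ r) s≥1 lin closed zero j (_ , j<a) (divides k hook≡ks)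
  with y , y∉r , eq ← hook-hole r j lin j<a =
  y∉a∷r (subst (_∈ beta (a ∷ r)) top∸ks≡y (closed-iterate k closed (here refl) ks≤top))
  where
    rowHook≡ks : rowHook r a j ≡ k * s
    rowHook≡ks = trans (sym (hook-head r j<a)) hook≡ks
    ks≤top : k * s ≤ a + length r
    ks≤top = subst₂ _≤_ rowHook≡ks eq (m≤m+n (rowHook r a j) y)
    top∸ks≡y : a + length r ∸ k * s ≡ y
    top∸ks≡y = trans (cong (_∸ k * s) (sym eq)) (trans (cong (λ h → h + y ∸ k * s) rowHook≡ks) (m+n∸m≡n (k * s) y))
    y∉a∷r : y ∉ beta (a ∷ r)
    y∉a∷r (here y≡top) = <-irrefl y≡top (hook-pos {r} {a} eq)
    y∉a∷r (there y∈r)  = y∉r y∈r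

-- Runners of the T-abacus, for a modulus T = t′ + 1 ≥ 1

module Abacus (t′ : ℕ) where

  T : ℕ
  T = suc t′

  division : ∀ y → y ≡ y % T + (y / T) * T
  division y = m≡m%n+[m/n]*n y T

  quotient-injective : ∀ {i q q′} → i + q * T ≡ i + q′ * T → q ≡ q′
  quotient-injective {i} {q} {q′} eq = *-cancelʳ-≡ q q′ T (+-cancelˡ-≡ i _ _ eq)

  remainder-of : ∀ {i} q → i < T → (i + q * T) % T ≡ i
  remainder-of {i} q i<T = trans ([m+kn]%n≡m%n i q T) (m<n⇒m%n≡m i<T)

  quotient-of : ∀ {i} q → i < T → (i + q * T) / T ≡ q
  quotient-of {i} q i<T = sym (quotient-injective (trans (division (i + q * T)) (cong (_+ (i + q * T) / T * T) (remainder-of q i<T))))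

  division-unique : ∀ {i i′ q q′} → i < T → i′ < T → i + q * T ≡ i′ + q′ * T → i ≡ i′ × q ≡ q′
  division-unique {i} {i′} {q} {q′} i<T i′<T eq = i≡i′ , quotient-injective (trans eq (cong (_+ q′ * T) (sym i≡i′)))
    where i≡i′ = trans (sym (remainder-of q i<T)) (trans (cong (_% T) eq) (remainder-of q′ i′<T))

  bead-down : ∀ i q → i + suc q * T ∸ T ≡ i + q * T
  bead-down i q = trans (cong (_∸ T) (regroup i q T)) (m+n∸m≡n T (i + q * T))
    where regroup : ∀ i q T → i + (T + q * T) ≡ T + (i + q * T)
          regroup = solve-∀

  T≤bead : ∀ i q → T ≤ i + suc q * T
  T≤bead i q = ≤-trans (m≤m+n T (q * T)) (m≤n+m (suc q * T) i)

  runner : ℕ → ℕ → List ℕ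
  runner i n = applyDownFrom (λ q → i + q * T) n

  ∈-runner⁺ : ∀ {i q n} → q < n → i + q * T ∈ runner i n
  ∈-runner⁺ = ∈-applyDownFrom⁺ _

  ∈-runner⁻ : ∀ {i q n} → i + q * T ∈ runner i n → q < n
  ∈-runner⁻ {n = n} b∈ with q′ , q′<n , eq ← ∈-applyDownFrom⁻ _ b∈ = subst (_< n) (sym (quotient-injective eq)) q′<n

  next-bead : ∀ {i} q n → All (_< i + q * T) (runner i n) →
              (T ≤ i + q * T → i + q * T ∸ T ∈ runner i n) → q ≡ n
  next-bead zero zero _ _ = refl
  next-bead {i} (suc q) zero _ predecessor with predecessor (T≤bead i q)
  ... | ()
  next-bead {i} zero (suc n) (top<b ∷ _) _ = ⊥-elim (<⇒≱ top<b (+-monoʳ-≤ i z≤n))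
  next-bead {i} (suc q) (suc n) (top<b ∷ _) predecessor = cong suc (≤-antisym (≤-pred q<1+n) n≤q)
    where
      q<1+n : q < suc n
      q<1+n = ∈-runner⁻ (subst (_∈ runner i (suc n)) (bead-down i q) (predecessor (T≤bead i q)))
      n≤q : n ≤ q
      n≤q = ≤-pred (*-cancelʳ-< T n (suc q) (+-cancelˡ-< i _ _ top<b))

  runner-shape : ∀ {i} F → Linked _>_ F → All (λ x → x % T ≡ i) F → Closed T F → F ≡ runner i (length F)
  runner-shape []      _   _              _      = refl
  runner-shape {i} (x ∷ F) lin (x%T≡i ∷ F%T≡i) closed = cong₂ _∷_ x≡next F≡runner
    where
      F≡runner : F ≡ runner i (length F)
      F≡runner = runner-shape F (Linked.tail lin) F%T≡i (closed-tail (s≤s z≤n) lin closed)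
      x≡ : x ≡ i + (x / T) * T
      x≡ = trans (division x) (cong (_+ (x / T) * T) x%T≡i)
      above : All (_< i + (x / T) * T) (runner i (length F))
      above = subst (All _) F≡runner (subst (λ z → All (_< z) F) x≡ (below-head lin))
      predecessor : T ≤ i + (x / T) * T → i + (x / T) * T ∸ T ∈ runner i (length F)
      predecessor T≤b = subst (λ z → z ∸ T ∈ runner i (length F)) x≡
        (subst (_ ∈_) F≡runner (closed-below-head (s≤s z≤n) lin closed (here refl) (subst (T ≤_) (sym x≡) T≤b)))
      x≡next : x ≡ i + length F * T
      x≡next = trans x≡ (cong (λ q → i + q * T) (next-bead (x / T) (length F) above predecessor))

  -- The beads of B on runner i and their number nᵢ; by definition nCount T i l = count i (beta l).
  residue : ℕ → List ℕ → List ℕ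
  residue i B = filter (λ x → modℕ x T ≟ i) B

  count : ℕ → List ℕ → ℕ
  count i B = length (residue i B)

  residue-runner : ∀ {i B} → Linked _>_ B → Closed T B → residue i B ≡ runner i (count i B)
  residue-runner {i} {B} lin closed =
    runner-shape (residue i B) (filter⁺ (λ x → modℕ x T ≟ i) (λ x>y y>z → <-trans y>z x>y) lin) (all-filter _ B) closed′
    where
      closed′ : Closed T (residue i B)
      closed′ x∈ T≤x with x∈B , x%T≡i ← ∈-filter⁻ _ x∈ =
        ∈-filter⁺ _ (closed x∈B T≤x) (trans (m≤n⇒[n∸m]%m≡n%m T≤x) x%T≡i)

  bead⁺ : ∀ {i q B} → Linked _>_ B → Closed T B → q < count i B → i + q * T ∈ B
  bead⁺ lin closed q<n = proj₁ (∈-filter⁻ _ (subst (_ ∈_) (sym (residue-runner lin closed)) (∈-runner⁺ q<n)))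

  bead⁻ : ∀ {i q B} → i < T → Linked _>_ B → Closed T B → i + q * T ∈ B → q < count i B
  bead⁻ {q = q} i<T lin closed b∈B =
    ∈-runner⁻ (subst (_ ∈_) (residue-runner lin closed) (∈-filter⁺ _ b∈B (remainder-of q i<T)))

  -- In a T-closed set, subtracting T repeatedly from x reaches its first position x mod T.
  remainder-∈ : ∀ {B x} → Closed T B → x ∈ B → x % T ∈ B
  remainder-∈ {B} {x} closed x∈B =
    subst (_∈ B) (sym (m%n≡m∸m/n*n x T)) (closed-iterate (x / T) closed x∈B (m/n*n≤m x T))

  ψ-counts : ∀ l → ψ T l ≡ applyUpTo (λ j → count (suc j) (beta l)) t′
  ψ-counts l = trans (cong (map (λ i → nCount T i l)) (map-upTo suc t′)) (map-applyUpTo suc (λ i → nCount T i l) t′)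

  module BetaSet {m l} (λ∈S : InS m T l) where
    gapped : Linked Gap (beta l)
    gapped = beta-gap l (proj₂ (proj₁ λ∈S))

    decreasing : Linked _>_ (beta l)
    decreasing = gap⇒decreasing gapped

    positive : All (1 ≤_) (beta l)
    positive = beta-positive l (proj₁ (proj₁ λ∈S))

    T-closed : Closed T (beta l)
    T-closed = core⇒closed l (s≤s z≤n) (proj₂ (proj₁ λ∈S)) (proj₁ (proj₂ λ∈S))

    mT+1-closed : Closed (m * T + 1) (beta l)
    mT+1-closed = core⇒closed l (m≤n+m 1 (m * T)) (proj₂ (proj₁ λ∈S)) (proj₂ (proj₂ λ∈S))

    top-bead : ∀ j → 0 < count (suc j) (beta l) → suc j ∈ beta l
    top-bead j n>0 = subst (_∈ beta l) (+-identityʳ (suc j)) (bead⁺ decreasing T-closed n>0)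

  ψ-into-C : ∀ m l → InS m T l → InC m T (ψ T l)
  ψ-into-C m l λ∈S rewrite ψ-counts l =
    length-applyUpTo n t′ , applyUpTo⁺₂ n t′ bounded , AdjZero-table n t′ adjacent
    where
      open BetaSet {m} λ∈S
      n : ℕ → ℕ
      n j = count (suc j) (beta l)
      -- n_{j+1} > m puts the bead j + 1 + mT in β, hence j = (j + 1 + mT) − (mT + 1), next to j + 1.
      bounded : ∀ j → n j ≤ m
      bounded j with m <? n j
      ... | no  m≮n = ≮⇒≥ m≮n
      ... | yes m<n = ⊥-elim (no-consecutive gapped j∈ (top-bead j (≤-<-trans z≤n m<n)))
        where
          shift : suc j + m * T ∸ (m * T + 1) ≡ j
          shift = trans (cong (suc j + m * T ∸_) (+-comm (m * T) 1)) (m+n∸n≡m j (m * T))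
          j∈ : j ∈ beta l
          j∈ = subst (_∈ beta l) shift (mT+1-closed (bead⁺ decreasing T-closed m<n)
                 (subst (_≤ suc j + m * T) (+-comm 1 (m * T)) (s≤s (m≤n+m (m * T) j))))
      -- Two adjacent nonempty runners put both j + 1 and j + 2 in β.
      adjacent : ∀ j → n j * n (suc j) ≡ 0
      adjacent j = product-zero (n j) (n (suc j))
        (λ n>0 n′>0 → no-consecutive gapped (top-bead j n>0) (top-bead (suc j) n′>0))

  same-beads : ∀ {B B′} → All (1 ≤_) B → Linked _>_ B → Closed T B → Linked _>_ B′ → Closed T B′ →
               (∀ {j} → j < t′ → count (suc j) B ≡ count (suc j) B′) → ∀ {x} → x ∈ B → x ∈ B′
  same-beads {B} {B′} pos lin closed lin′ closed′ same-count {x} x∈B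
    with x % T in x%T≡ | remainder-∈ closed x∈B | m%n<n x T
  ... | zero  | 0∈B | _         = ⊥-elim (<-irrefl refl (All.lookup pos 0∈B))
  ... | suc j | _   | s≤s j<t′ =
    subst (_∈ B′) (sym x≡) (bead⁺ lin′ closed′ (subst (x / T <_) (same-count j<t′)
      (bead⁻ (s≤s j<t′) lin closed (subst (_∈ B) x≡ x∈B))))
    where x≡ : x ≡ suc j + (x / T) * T
          x≡ = trans (division x) (cong (_+ (x / T) * T) x%T≡)

  -- ψ is injective on S⁺_{m,T}: the counts determine β(λ), which determines λ.
  ψ-injective : ∀ m l l′ → InS m T l → InS m T l′ → ψ T l ≡ ψ T l′ → l ≡ l′
  ψ-injective m l l′ λ∈S λ′∈S ψ≡ = beta-injective l l′
    (decreasing-ext β.decreasing β′.decreasing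
      (same-beads β.positive β.decreasing β.T-closed β′.decreasing β′.T-closed same-count)
      (same-beads β′.positive β′.decreasing β′.T-closed β.decreasing β.T-closed (λ j<t′ → sym (same-count j<t′))))
    where
      module β = BetaSet {m} λ∈S
      module β′ = BetaSet {m} λ′∈S
      same-count : ∀ {j} → j < t′ → count (suc j) (beta l) ≡ count (suc j) (beta l′)
      same-count = applyUpTo-injective _ _ t′ (trans (sym (ψ-counts l)) (trans ψ≡ (ψ-counts l′)))

  -- The preimage of xs ∈ C⁺_{m,T}: the β-set of all beads j + 1 + qT with j + 1 < T and
  -- q < x_{j+1} = part xs j.  They all lie below mT.
  module Preimage (m : ℕ) (xs : List ℕ) (xs≤m : All (_≤ m) xs) (adj : AdjZero xs) where
    IsBead : ℕ → Set
    IsBead y = ¬ (y % T ≡ 0) × (y / T < part xs (y % T ∸ 1))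

    bead? : (y : ℕ) → Dec (IsBead y)
    bead? y = ¬? (y % T ≟ 0) ×-dec (y / T <? part xs (y % T ∸ 1))

    -- Listing the beads from the decreasing list mT − 1, …, 0 sorts them.
    B : List ℕ
    B = filter bead? (downFrom (m * T))

    decreasing : Linked _>_ B
    decreasing = filter⁺ bead? (λ x>y y>z → <-trans y>z x>y) (applyDownFrom⁺₂ (λ x → x) (m * T) n<1+n)

    ∈B-split : ∀ {y} → y ∈ B → y < m * T × IsBead y
    ∈B-split y∈B with y∈ , bead ← ∈-filter⁻ bead? {xs = downFrom (m * T)} y∈B = ∈-downFrom⁻ y∈ , bead

    ∈B⁻ : ∀ {y} → y ∈ B → ∃₂ λ j q → suc j < T × q < part xs j × y ≡ suc j + q * T
    ∈B⁻ {y} y∈B with y % T in y%T≡ | m%n<n y T | proj₂ (∈B-split y∈B)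
    ... | zero  | _   | y%T≢0 , _ = ⊥-elim (y%T≢0 refl)
    ... | suc j | j<T | _ , q<x   = j , y / T , j<T , q<x , trans (division y) (cong (_+ (y / T) * T) y%T≡)

    ∈B⁺ : ∀ {j q} → suc j < T → q < part xs j → suc j + q * T ∈ B
    ∈B⁺ {j} {q} j<T q<x = ∈-filter⁺ bead? (∈-downFrom⁺ below-mT) (remainder≢0 , quotient<x)
      where
        below-mT : suc j + q * T < m * T
        below-mT = <-≤-trans (+-monoˡ-< (q * T) j<T) (*-monoˡ-≤ T (≤-trans q<x (part-bounded xs xs≤m j)))
        remainder≢0 : ¬ ((suc j + q * T) % T ≡ 0)
        remainder≢0 r≡0 = 1+n≢0 (trans (sym (remainder-of q j<T)) r≡0)
        quotient<x : (suc j + q * T) / T < part xs ((suc j + q * T) % T ∸ 1)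
        quotient<x = subst₂ (λ a b → a < part xs (b ∸ 1)) (sym (quotient-of q j<T)) (sym (remainder-of q j<T)) q<x

    bead-in-B⁻ : ∀ {j q} → suc j < T → suc j + q * T ∈ B → q < part xs j
    bead-in-B⁻ {q = q} j<T b∈B with j′ , q′ , j′<T , q′<x , eq ← ∈B⁻ b∈B
      with division-unique {q = q} {q′} j<T j′<T eq
    ... | refl , refl = q′<x

    -- Beads have nonzero remainder, hence are positive.
    positive : All (1 ≤_) B
    positive = All.tabulate λ y∈B → let (j , q , _ , _ , y≡) = ∈B⁻ y∈B in subst (1 ≤_) (sym y≡) (s≤s z≤n)

    -- y and y + 1 are never both beads: on adjacent runners j + 1, j + 2 they would give
    -- x_{j+1} x_{j+2} ≠ 0, and if j + 2 = T then y + 1 ≡ 0 (mod T) is no bead.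
    no-adjacent-beads : ∀ {y} → y ∈ B → suc y ∈ B → ⊥
    no-adjacent-beads y∈B y+1∈B
      with j , q , j<T , q<x , refl ← ∈B⁻ y∈B
      with j′ , q′ , j′<T , q′<x′ , eq ← ∈B⁻ y+1∈B
      with suc (suc j) <? T
    ... | yes j+2<T with refl , refl ← division-unique {q = q} {q′} j+2<T j′<T eq =
      product-zero⁻ (AdjZero-part xs adj j) (≤-<-trans z≤n q<x) (≤-<-trans z≤n q′<x′)
    ... | no j+2≮T = 0≢1+n (proj₁ (division-unique {q = suc q} {q′} (s≤s z≤n) j′<T (trans wrap eq)))
      where wrap : 0 + suc q * T ≡ suc (suc j) + q * T
            wrap = cong (_+ q * T) (≤-antisym (≮⇒≥ j+2≮T) j<T)

    gapped : Linked Gap B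
    gapped = decreasing⇒gap decreasing no-adjacent-beads

    -- Subtracting T moves a bead one position back along its runner, where it is still a bead.
    T-closed : Closed T B
    T-closed y∈B T≤y with ∈B⁻ y∈B
    ... | j , zero  , j<T , _   , refl = ⊥-elim (<⇒≱ j<T (subst (T ≤_) (+-identityʳ (suc j)) T≤y))
    ... | j , suc q , j<T , q<x , refl = subst (_∈ B) (sym (bead-down (suc j) q)) (∈B⁺ j<T (<-trans (n<1+n q) q<x))

    -- Nothing in B reaches mT + 1, so closure under −(mT + 1) is vacuous.
    mT+1-closed : Closed (m * T + 1) B
    mT+1-closed y∈B mT+1≤y = ⊥-elim (<⇒≱ (proj₁ (∈B-split y∈B)) (≤-trans (m≤m+n (m * T) 1) mT+1≤y))

    λ₀ : List ℕ
    λ₀ = unbeta B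

    β-λ₀ : beta λ₀ ≡ B
    β-λ₀ = beta-unbeta B decreasing

    λ₀-in-S : InS m T λ₀
    λ₀-in-S = (unbeta-positive B decreasing positive , distinct) ,
              closed⇒core λ₀ (s≤s z≤n) distinct (subst (Closed T) (sym β-λ₀) T-closed) ,
              closed⇒core λ₀ (m≤n+m 1 (m * T)) distinct (subst (Closed (m * T + 1)) (sym β-λ₀) mT+1-closed)
      where distinct = unbeta-decreasing B gapped

    -- Runner j + 1 holds the bead j + 1 + qT iff q < n_{j+1} iff q < x_{j+1}.
    count-B : ∀ {j} → j < t′ → count (suc j) B ≡ part xs j
    count-B j<t′ = ≡-by-lower-sets (λ q<n → bead-in-B⁻ (s≤s j<t′) (bead⁺ decreasing T-closed q<n))
                                   (λ q<x → bead⁻ (s≤s j<t′) decreasing T-closed (∈B⁺ (s≤s j<t′) q<x))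

    ψ-λ₀ : length xs ≡ t′ → ψ T λ₀ ≡ xs
    ψ-λ₀ length≡ = begin
      ψ T λ₀                                        ≡⟨ ψ-counts λ₀ ⟩
      applyUpTo (λ j → count (suc j) (beta λ₀)) t′  ≡⟨ cong (λ C → applyUpTo (λ j → count (suc j) C) t′) β-λ₀ ⟩
      applyUpTo (λ j → count (suc j) B) t′          ≡⟨ applyUpTo-cong _ _ t′ count-B ⟩
      applyUpTo (part xs) t′                        ≡⟨ cong (applyUpTo (part xs)) (sym length≡) ⟩
      applyUpTo (part xs) (length xs)               ≡⟨ sym (part-table xs) ⟩
      xs                                            ∎
      where open ≡-Reasoning

-- Theorem 3.1.  With T = t, ψ maps S⁺_{m,t} into C⁺_{m,t}, is injective there, and every
-- x ∈ C⁺_{m,t} is ψ of the partition whose β-set consists of the beads prescribed by x.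
-- (The argument does not need the hypotheses t ≥ 2 and m ≥ 1.)
theorem3p1 : (t m : ℕ) → 2 ≤ t → 1 ≤ m →
    ((l : List ℕ) → InS m t l → InC m t (ψ t l))
    × ((l l′ : List ℕ) → InS m t l → InS m t l′ → ψ t l ≡ ψ t l′ → l ≡ l′)
    × ((x : List ℕ) → InC m t x → ∃ λ l → InS m t l × ψ t l ≡ x)
theorem3p1 (suc t′) m _ _ =
  ψ-into-C m , ψ-injective m , preimage
  where
    open Abacus t′
    preimage : (xs : List ℕ) → InC m (suc t′) xs → ∃ λ l → InS m (suc t′) l × ψ (suc t′) l ≡ xs
    preimage xs (length≡ , xs≤m , adj) = λ₀ , λ₀-in-S , ψ-λ₀ length≡
      where open Preimage m xs xs≤m adj
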